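{- Let $G$ be an embedded graph (ribbon graph). Then \[ P(G;\lambda)=\sum_{A\subseteq E(G)} (-1)^{|A|}\,\lambda^{f(G^{\tau(A)})}, \] where $f(H)$ denotes the number of faces of $H$ (the number of boundary components of the ribbon graph $H$).
   Context: An embedded graph is a graph cellularly embedded in a closed (possibly non-orientable) surface, considered up to homeomorphism; equivalently a ribbon graph (vertex discs and edge discs glued along disjoint arcs, each edge disc meeting vertices in exactly two arcs). It may be encoded by an arrow presentation: one circle per vertex (the boundary of the vertex disc), carrying disjoint arrows, where each edge label appears on exactly two arrows (the two arcs where that edge disc is attached, oriented consistently with a chosen orientation of the edge disc); presentations are equivalent up to reversing both arrows of a label and relabelling. For $A\subseteq E(G)$, the partial Petrial $G^{\tau(A)}$ is obtained by, for each $e\in A$, reversing exactly one of the two arrows labelled $e$ (i.e. giving the edge $e$ a half-twist). Penrose polynomial: the medial graph $G_m$ is obtained by placing a degree-4 vertex $v_e$ on each edge $e$ of $G$ and joining these vertices by edges following the face boundaries of $G$; each isolated vertex of $G$ contributes a closed curve without vertices. $G_m$ is embedded in the same surface, and its canonical checkerboard colouring colours a face of $G_m$ black if it contains a vertex of $G$ and white otherwise. At each $v_e$ there are three vertex states (pairings of the four half-edges): the white split (half-edges paired so that each pair is consecutive around $v_e$ and bounds a white corner), the black split (same with black corners), and the crossing (opposite half-edges paired). A graph state $s$ is a choice of vertex state at every vertex; $c(s)$ is the number of resulting closed curves (components) and $cr(s)$ the number of crossing vertex states. A Penrose state is a state with no black splits. The Penrose polynomial is $P(G;\lambda)=\sum_{s}(-1)^{cr(s)}\lambda^{c(s)}$,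 summed over Penrose states $s$ of $G_m$. -}

module Defs where

open import Data.Nat using (ℕ; zero; suc; _+_; _≡ᵇ_)
open import Data.Bool using (Bool; true; false; not; if_then_else_; _∧_; _∨_)
open import Data.Fin using (Fin; toℕ)
open import Data.List using (List; []; _∷_; _++_; map; concatMap; concat; allFin; zipWith; filterᵇ; foldr; length; null)
open import Data.Bool.ListAction using (any)
open import Data.Vec using (Vec; []; _∷_; lookup)
open import Data.Fin.Subset using (Subset; Side; inside; outside; ∣_∣)
open import Data.Integer using (ℤ; 0ℤ; 1ℤ; -_; _^_) renaming (_+_ to _+ℤ_)
open import Data.Product using (_×_; _,_; proj₁; proj₂)
open import Data.List.Relation.Binary.Permutation.Propositional using (_↭_)

-- Arrow presentations of embedded (ribbon) graphs.
--
-- Each edge label e has exactly two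
-- arrows, which we name by the "ends" (e , false) and (e , true).
-- Each vertex circle carries a list of arrows, listed in the cyclic order
-- in which they occur along the circle (w.r.t. an arbitrarily chosen
-- traversal direction of that circle).  The Bool attached to an arrow is
-- its direction: true = the arrow points along the traversal direction,
-- false = against it.

End : ℕ → Set
End n = Fin n × Bool

Arrow : ℕ → Set
Arrow n = End n × Bool

record ArrowPresentation : Set where
  field
    nV     : ℕ
    nE     : ℕ
    circle : Fin nV → List (Arrow nE)

open ArrowPresentation public

allEnds : (n : ℕ) → List (End n)
allEnds n = concatMap (λ e → (e , false) ∷ (e , true) ∷ []) (allFin n)

allArrows : (G : ArrowPresentation) → List (Arrow (nE G))
allArrows G = concatMap (circle G) (allFin (nV G))

-- Well-formedness: every edge label occurs on exactly two arrows
-- (i.e. every end occurs exactly once among all arrows).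
IsArrowPresentation : ArrowPresentation → Set
IsArrowPresentation G = map proj₁ (allArrows G) ↭ allEnds (nE G)

-- Endpoints of arrows: (end , false) = tail, (end , true) = head.

Pt : ℕ → Set
Pt n = End n × Bool

allPts : (n : ℕ) → List (Pt n)
allPts n = concatMap (λ x → (x , false) ∷ (x , true) ∷ []) (allEnds n)

_==F_ : {n : ℕ} → Fin n → Fin n → Bool
i ==F j = toℕ i ≡ᵇ toℕ j

_==B_ : Bool → Bool → Bool
true  ==B b = b
false ==B b = not b

_==P_ : {n : ℕ} → Pt n → Pt n → Bool
((e , s) , h) ==P ((e' , s') , h') = (e ==F e') ∧ ((s ==B s') ∧ (h ==B h'))

module _ {n : ℕ} where
  memb : Pt n → List (Pt n) → Bool
  memb x = any (x ==P_)

  step : List (Pt n × Pt n) → List (Pt n) → List (Pt n)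
  step E S = S ++ concatMap (λ ab → (if memb (proj₁ ab) S then proj₂ ab ∷ [] else [])
                                   ++ (if memb (proj₂ ab) S then proj₁ ab ∷ [] else [])) E

  iter : ℕ → List (Pt n × Pt n) → List (Pt n) → List (Pt n)
  iter zero    E S = S
  iter (suc k) E S = iter k E (step E S)

  -- everything reachable from x (paths of length ≤ number of vertices)
  closure : List (Pt n) → List (Pt n × Pt n) → Pt n → List (Pt n)
  closure V E x = iter (length V) E (x ∷ [])

  countReps : List (Pt n) → List (Pt n × Pt n) → List (Pt n) → List (Pt n) → ℕ
  countReps V E pre []       = 0
  countReps V E pre (x ∷ xs) =
    (if any (λ y → memb x (closure V E y)) pre then 0 else 1)
    + countReps V E (pre ++ (x ∷ [])) xs

  components : List (Pt n) → List (Pt n × Pt n) → ℕ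
  components V E = countReps V E [] V

-- Vertex-circle gaps: the arcs of a vertex circle between consecutive
-- arrows.  Traversing the circle, arrow (x , d) is entered at its tail and
-- left at its head if d = true, and the other way round if d = false.

entryPt : {n : ℕ} → Arrow n → Pt n
entryPt (x , d) = (x , not d)

exitPt : {n : ℕ} → Arrow n → Pt n
exitPt (x , d) = (x , d)

rotate : {A : Set} → List A → List A
rotate []       = []
rotate (x ∷ xs) = xs ++ (x ∷ [])

gaps : {n : ℕ} → List (Arrow n) → List (Pt n × Pt n)
gaps xs = zipWith (λ a b → (exitPt a , entryPt b)) xs (rotate xs)

allGaps : (G : ArrowPresentation) → List (Pt (nE G) × Pt (nE G))
allGaps G = concatMap (λ v → gaps (circle G v)) (allFin (nV G))

isolated : ArrowPresentation → ℕ
isolated G = length (filterᵇ (λ v → null (circle G v)) (allFin (nV G)))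

-- The edge disc of e is glued so that the
-- two arrows follow one orientation of its boundary, so its two free
-- sides join head(e,false)–tail(e,true) and head(e,true)–tail(e,false).

edgeSides : {n : ℕ} → Fin n → List (Pt n × Pt n)
edgeSides e = (((e , false) , true) , ((e , true) , false))
            ∷ (((e , true) , true) , ((e , false) , false)) ∷ []

faces : ArrowPresentation → ℕ
faces G = components (allPts (nE G)) (allGaps G ++ concatMap edgeSides (allFin (nE G)))
          + isolated G

-- Partial Petrial: for e ∈ A reverse exactly one arrow labelled e
-- (we reverse the arrow (e , true)).

inA : {n : ℕ} → Subset n → Fin n → Bool
inA A e with lookup A e
... | inside  = true
... | outside = false

partialPetrial : (G : ArrowPresentation) → Subset (nE G) → ArrowPresentation
partialPetrial G A = record
  { nV = nV G
  ; nE = nE G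
  ; circle = λ v → map (λ a → flipIf a) (circle G v)
  }
  where
  flipIf : Arrow (nE G) → Arrow (nE G)
  flipIf ((e , s) , d) = ((e , s) , (if s ∧ inA A e then not d else d))

-- Vertex v_e of G_m has as its four half-edges the four
-- arrow endpoints labelled e (cyclic order t1,h1,t2,h2 around v_e);
-- the edges of G_m are the vertex-circle gaps (corners of G), and
-- each isolated vertex of G gives a closed curve without vertices.
-- Black corners at v_e (inside a vertex disc): {t1,h1}, {t2,h2};
-- white corners (along the edge sides): {h1,t2}, {h2,t1}.

data VState : Set where
  whiteSplit blackSplit crossing : VState

split : {n : ℕ} → Fin n → VState → List (Pt n × Pt n)
split e whiteSplit = edgeSides e
split e blackSplit = (((e , false) , false) , ((e , false) , true))
                   ∷ (((e , true) , false) , ((e , true) , true)) ∷ []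
split e crossing   = (((e , false) , false) , ((e , true) , false))
                   ∷ (((e , false) , true) , ((e , true) , true)) ∷ []

GraphState : ArrowPresentation → Set
GraphState G = Vec VState (nE G)

curves : (G : ArrowPresentation) → GraphState G → ℕ
curves G s = components (allPts (nE G))
               (allGaps G ++ concatMap (λ e → split e (lookup s e)) (allFin (nE G)))
             + isolated G

isCrossing : VState → Bool
isCrossing crossing = true
isCrossing _        = false

isBlack : VState → Bool
isBlack blackSplit = true
isBlack _          = false

cr : {n : ℕ} → Vec VState n → ℕ
cr []       = 0
cr (x ∷ xs) = (if isCrossing x then 1 else 0) + cr xs

isPenrose : {n : ℕ} → Vec VState n → Bool
isPenrose []       = true
isPenrose (x ∷ xs) = not (isBlack x) ∧ isPenrose xs

allVecs : {A : Set} → List A → (n : ℕ) → List (Vec A n)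
allVecs xs zero    = [] ∷ []
allVecs xs (suc n) = concatMap (λ x → map (x ∷_) (allVecs xs n)) xs

-- Polynomials in λ over ℤ, as coefficient sequences
-- (p d = coefficient of λ^d).

Poly : Set
Poly = ℕ → ℤ

monomial : ℤ → ℕ → Poly
monomial z c d = if c ≡ᵇ d then z else 0ℤ

sumP : List Poly → Poly
sumP ps d = foldr (λ p acc → p d +ℤ acc) 0ℤ ps

penrosePoly : ArrowPresentation → Poly
penrosePoly G = sumP (map (λ s → monomial ((- 1ℤ) ^ cr s) (curves G s))
                          (filterᵇ isPenrose
                             (allVecs (whiteSplit ∷ blackSplit ∷ crossing ∷ []) (nE G))))

petrialSum : ArrowPresentation → Poly
petrialSum G = sumP (map (λ A → monomial ((- 1ℤ) ^ ∣ A ∣) (faces (partialPetrial G A)))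
                         (allVecs (outside ∷ inside ∷ []) (nE G)))

-- For A ⊆ E(G) let s_A be the Penrose state with crossings on A and white splits elsewhere;
-- A ↦ s_A enumerates the Penrose states and cr(s_A) = |A|.  It remains to see c(s_A) = f(G^τ(A)).
-- Exchange the head and tail of the arrow (e , true) for every e ∈ A.  This involution of the
-- arrow endpoints carries the corners of G to those of G^τ(A), and the two sides of a half-twisted
-- edge to the crossing pairing of its medial vertex (the sides of an untwisted edge are its white
-- split).  So the curves of s_A and the face boundaries of G^τ(A) are the connected components of
-- two graphs on the endpoints that correspond under a permutation, and they are equinumerous.
module Submission where

open import Defs
open import Data.Nat using (ℕ; zero; suc; _+_; _≤_; _<_; z≤n; s≤s)
open import Data.Nat.Properties
  using (≡ᵇ⇒≡; ≡⇒≡ᵇ; +-assoc; +-mono-≤; +-mono-<-≤; +-mono-≤-<; <-≤-trans)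
open import Data.Bool using (Bool; true; false; not; if_then_else_; _∧_; _∨_; T)
open import Data.Bool.Properties using (T-∧; ∨-assoc; ∨-identityʳ; not-involutive)
open import Data.Bool.ListAction using (any; or)
open import Data.Unit using (tt)
open import Data.Empty using (⊥-elim)
open import Data.Fin using (Fin; toℕ)
open import Data.Fin.Properties using (toℕ-injective)
open import Data.Fin.Subset using (Subset; Side; inside; outside; ∣_∣)
open import Data.List using (List; []; _∷_; _++_; [_]; map; concatMap; allFin; length; zipWith; filterᵇ; null)
open import Data.List.Properties
  using (map-++; map-∘; map-cong; concatMap-cong; concatMap-map; map-concatMap; zipWith-cong; zipWith-map;
         map-zipWith; filter-++; filter-none; filter-≐; ++-assoc)
open import Data.List.Relation.Binary.Subset.Propositional using (_⊆_)
open import Data.List.Relation.Unary.Any as Any using (here; there)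
open import Data.List.Relation.Unary.Any.Properties using (any⇔)
open import Data.List.Relation.Unary.All as All using (all?)
open import Data.List.Relation.Unary.All.Properties using (¬All⇒Any¬)
open import Data.List.Membership.Propositional using (_∈_; find; lose)
open import Data.List.Membership.Propositional.Properties
  using (∈-map⁺; ∈-map⁻; ∈-++⁺ˡ; ∈-++⁺ʳ; ∈-++⁻; ∈-concatMap⁺; ∈-concatMap⁻; ∈-allFin)
open import Data.List.Relation.Binary.Permutation.Propositional as ↭ using (_↭_; ↭-sym; ↭-reflexive)
open import Data.List.Relation.Binary.Permutation.Propositional.Properties using (Any-resp-↭; ++⁺; ++⁺ʳ)
open import Data.Vec as Vec using (Vec; lookup) renaming ([] to []ᵥ; _∷_ to _∷ᵥ_)
open import Data.Vec.Properties using (lookup-map)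
open import Data.Integer using (1ℤ; -_; _^_)
open import Data.Product as Product using (_×_; _,_; ∃-syntax)
open import Data.Sum using (_⊎_; inj₁; inj₂)
open import Function using (_∘_; _⇔_; mk⇔; Equivalence)
open import Relation.Nullary using (¬_; yes; no)
open import Relation.Nullary.Decidable using (T?)
open import Relation.Binary.Construct.Closure.Symmetric as SymClosure using (SymClosure; fwd; bwd)
open import Relation.Binary.Construct.Closure.ReflexiveTransitive as Star using (ε; _◅_)
open import Relation.Binary.Construct.Closure.Equivalence as EqClosure using (EqClosure)
open import Relation.Binary.PropositionalEquality
  using (_≡_; refl; sym; trans; cong; cong₂; subst; subst₂; module ≡-Reasoning)

open Equivalence using (to; from)

private
  variable
    A B : Set

T-injective : ∀ {a b} → T a ⇔ T b → a ≡ b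
T-injective {false} {false} _   = refl
T-injective {false} {true}  a⇔b = ⊥-elim (from a⇔b tt)
T-injective {true}  {false} a⇔b = ⊥-elim (to a⇔b tt)
T-injective {true}  {true}  _   = refl

any-cong : ∀ {p q : A → Bool} → (∀ x → p x ≡ q x) → ∀ xs → any p xs ≡ any q xs
any-cong p≗q xs = cong or (map-cong p≗q xs)

any-map : ∀ (p : B → Bool) (f : A → B) xs → any p (map f xs) ≡ any (p ∘ f) xs
any-map p f xs = cong or (sym (map-∘ xs))

any-∷ʳ : ∀ (p : A → Bool) xs x → any p (xs ++ [ x ]) ≡ any p xs ∨ p x
any-∷ʳ p []       x = ∨-identityʳ (p x)
any-∷ʳ p (y ∷ xs) x = trans (cong (p y ∨_) (any-∷ʳ p xs x)) (sym (∨-assoc (p y) _ _))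

any-↭ : ∀ (p : A → Bool) {xs ys} → xs ↭ ys → any p xs ≡ any p ys
any-↭ p xs↭ys = T-injective (mk⇔ (to any⇔ ∘ Any-resp-↭ xs↭ys ∘ from any⇔)
                                 (to any⇔ ∘ Any-resp-↭ (↭-sym xs↭ys) ∘ from any⇔))

∈-if⁻ : ∀ {x y : A} c → x ∈ (if c then y ∷ [] else []) → T c × x ≡ y
∈-if⁻ true (here refl) = tt , refl

∈-if⁺ : ∀ {y : A} {c} → T c → y ∈ (if c then y ∷ [] else [])
∈-if⁺ {c = true} _ = here refl

∈-map-involution : ∀ (f : A → A) → (∀ x → f (f x) ≡ x) → ∀ {x xs} → x ∈ map f xs → f x ∈ xs
∈-map-involution f f-involutive x∈ with y , y∈ , refl ← ∈-map⁻ f x∈ =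
  subst (_∈ _) (sym (f-involutive y)) y∈

concatMap-↭ : ∀ {f g : A → List B} → (∀ x → f x ↭ g x) → ∀ xs → concatMap f xs ↭ concatMap g xs
concatMap-↭ f↭g []       = ↭.refl
concatMap-↭ f↭g (x ∷ xs) = ++⁺ (f↭g x) (concatMap-↭ f↭g xs)

null-map : ∀ (f : A → B) xs → null (map f xs) ≡ null xs
null-map f []       = refl
null-map f (x ∷ xs) = refl

filterᵇ-map : ∀ (p : B → Bool) (f : A → B) xs → filterᵇ p (map f xs) ≡ map f (filterᵇ (p ∘ f) xs)
filterᵇ-map p f []       = refl
filterᵇ-map p f (x ∷ xs) with p (f x)
... | true  = cong (f x ∷_) (filterᵇ-map p f xs)
... | false = filterᵇ-map p f xs

filterᵇ-concatMap : ∀ (p : B → Bool) (f : A → List B) xs →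
                    filterᵇ p (concatMap f xs) ≡ concatMap (filterᵇ p ∘ f) xs
filterᵇ-concatMap p f []       = refl
filterᵇ-concatMap p f (x ∷ xs) =
  trans (filter-++ (T? ∘ p) (f x) (concatMap f xs)) (cong (filterᵇ p (f x) ++_) (filterᵇ-concatMap p f xs))

-- Counting classes

unseen : Bool → ℕ
unseen b = if b then 0 else 1

unseen-anti : ∀ {b b′} → (T b → T b′) → unseen b′ ≤ unseen b
unseen-anti {true}  {true}  _ = z≤n
unseen-anti {true}  {false} f = ⊥-elim (f tt)
unseen-anti {false} {true}  _ = z≤n
unseen-anti {false} {false} _ = s≤s z≤n

unseen-< : ∀ {b b′} → T b′ → ¬ T b → unseen b′ < unseen b
unseen-< {true}         _ ¬b = ⊥-elim (¬b tt)
unseen-< {false} {true} _ _  = s≤s z≤n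

unseen-swap : ∀ pa pb r → (T r → T pa → T pb) → (T r → T pb → T pa) →
              unseen pa + unseen (pb ∨ r) ≡ unseen pb + unseen (pa ∨ r)
unseen-swap true  true  r     _ _ = refl
unseen-swap true  false true  f _ = ⊥-elim (f tt tt)
unseen-swap true  false false _ _ = refl
unseen-swap false true  true  _ g = ⊥-elim (g tt tt)
unseen-swap false true  false _ _ = refl
unseen-swap false false r     _ _ = refl

seen : (A → A → Bool) → List A → A → Bool
seen R pre x = any (λ y → R y x) pre

-- For an equivalence R, countNew R [] xs is the number of R-classes meeting xs.
countNew : (A → A → Bool) → List A → List A → ℕ
countNew R pre []       = 0
countNew R pre (x ∷ xs) = unseen (seen R pre x) + countNew R (pre ++ [ x ]) xs

countNew-map : ∀ (R : A → A → Bool) (R′ : B → B → Bool) (f : A → B) →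
               (∀ y x → R y x ≡ R′ (f y) (f x)) →
               ∀ pre xs → countNew R pre xs ≡ countNew R′ (map f pre) (map f xs)
countNew-map R R′ f R≡R′ pre []       = refl
countNew-map R R′ f R≡R′ pre (x ∷ xs) = cong₂ _+_
  (cong unseen (trans (any-cong (λ y → R≡R′ y x) pre) (sym (any-map _ f pre))))
  (trans (countNew-map R R′ f R≡R′ (pre ++ [ x ]) xs)
         (cong (λ pre′ → countNew R′ pre′ (map f xs)) (map-++ f pre [ x ])))

module _ (R : A → A → Bool) (R-sym : ∀ x y → R x y ≡ R y x)
         (R-trans : ∀ x y z → T (R x y) → T (R y z) → T (R x z)) where

  seen-trans : ∀ pre {a b} → T (R a b) → T (seen R pre a) → T (seen R pre b)
  seen-trans pre {a} {b} aRb = to any⇔ ∘ Any.map (λ {y} yRa → R-trans y a b yRa aRb) ∘ from (any⇔ {xs = pre})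

  seen-swap : ∀ pre a b → unseen (seen R pre a) + unseen (seen R (pre ++ [ a ]) b)
                        ≡ unseen (seen R pre b) + unseen (seen R (pre ++ [ b ]) a)
  seen-swap pre a b = begin
    unseen (seen R pre a) + unseen (seen R (pre ++ [ a ]) b)
      ≡⟨ cong (λ c → unseen (seen R pre a) + unseen c) (any-∷ʳ _ pre a) ⟩
    unseen (seen R pre a) + unseen (seen R pre b ∨ R a b)
      ≡⟨ unseen-swap _ _ (R a b) (seen-trans pre) (seen-trans pre ∘ subst T (R-sym a b)) ⟩
    unseen (seen R pre b) + unseen (seen R pre a ∨ R a b)
      ≡⟨ cong (λ c → unseen (seen R pre b) + unseen (seen R pre a ∨ c)) (R-sym a b) ⟩
    unseen (seen R pre b) + unseen (seen R pre a ∨ R b a)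
      ≡⟨ cong (λ c → unseen (seen R pre b) + unseen c) (any-∷ʳ _ pre b) ⟨
    unseen (seen R pre b) + unseen (seen R (pre ++ [ b ]) a) ∎
    where open ≡-Reasoning

  countNew-↭ : ∀ {pre pre′ xs ys} → pre ↭ pre′ → xs ↭ ys → countNew R pre xs ≡ countNew R pre′ ys
  countNew-↭ {xs = []}     pre↭ ↭.refl = refl
  countNew-↭ {xs = x ∷ xs} pre↭ ↭.refl =
    cong₂ _+_ (cong unseen (any-↭ _ pre↭)) (countNew-↭ (++⁺ʳ [ x ] pre↭) (↭.refl {xs = xs}))
  countNew-↭ pre↭ (↭.prep x xs↭ys) =
    cong₂ _+_ (cong unseen (any-↭ _ pre↭)) (countNew-↭ (++⁺ʳ [ x ] pre↭) xs↭ys)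
  countNew-↭ pre↭ (↭.trans xs↭ys ys↭zs) = trans (countNew-↭ pre↭ xs↭ys) (countNew-↭ ↭.refl ys↭zs)
  countNew-↭ {pre} {pre′} pre↭ (↭.swap {xs} {ys} a b xs↭ys) = begin
    unseen (seen R pre a) + (unseen (seen R (pre ++ [ a ]) b) + countNew R ((pre ++ [ a ]) ++ [ b ]) xs)
      ≡⟨ +-assoc (unseen (seen R pre a)) _ _ ⟨
    unseen (seen R pre a) + unseen (seen R (pre ++ [ a ]) b) + countNew R ((pre ++ [ a ]) ++ [ b ]) xs
      ≡⟨ cong₂ _+_ (seen-swap pre a b) (countNew-↭ prefixes xs↭ys) ⟩
    unseen (seen R pre b) + unseen (seen R (pre ++ [ b ]) a) + countNew R ((pre′ ++ [ b ]) ++ [ a ]) ys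
      ≡⟨ cong₂ (λ c d → unseen c + unseen d + _) (any-↭ _ pre↭) (any-↭ _ (++⁺ʳ [ b ] pre↭)) ⟩
    unseen (seen R pre′ b) + unseen (seen R (pre′ ++ [ b ]) a) + countNew R ((pre′ ++ [ b ]) ++ [ a ]) ys
      ≡⟨ +-assoc (unseen (seen R pre′ b)) _ _ ⟩
    unseen (seen R pre′ b) + (unseen (seen R (pre′ ++ [ b ]) a) + countNew R ((pre′ ++ [ b ]) ++ [ a ]) ys) ∎
    where
    open ≡-Reasoning
    prefixes : (pre ++ [ a ]) ++ [ b ] ↭ (pre′ ++ [ b ]) ++ [ a ]
    prefixes = ↭.trans (↭-reflexive (++-assoc pre [ a ] [ b ]))
                 (↭.trans (++⁺ pre↭ (↭.swap a b ↭.refl)) (↭-reflexive (sym (++-assoc pre′ [ b ] [ a ]))))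

-- Connectivity

Edge : List (A × A) → A → A → Set
Edge E a b = (a , b) ∈ E

Connected : List (A × A) → A → A → Set
Connected E = EqClosure (Edge E)

Connected-map : ∀ {E : List (A × A)} {E′ : List (B × B)} (σ : A → B) →
                (∀ {a b} → Edge E a b → SymClosure (Edge E′) (σ a) (σ b)) →
                ∀ {y x} → Connected E y x → Connected E′ (σ y) (σ x)
Connected-map σ step ε            = ε
Connected-map σ step (fwd ab ◅ c) = step ab ◅ Connected-map σ step c
Connected-map {E′ = E′} σ step (bwd ba ◅ c) =
  SymClosure.symmetric (Edge E′) (step ba) ◅ Connected-map σ step c

Connected-involution : ∀ {E E′ : List (A × A)} (σ : A → A) → (∀ x → σ (σ x) ≡ x) →
                       (∀ {a b} → Edge E a b → SymClosure (Edge E′) (σ a) (σ b)) →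
                       (∀ {a b} → Edge E′ a b → SymClosure (Edge E) (σ a) (σ b)) →
                       ∀ {y x} → Connected E y x ⇔ Connected E′ (σ y) (σ x)
Connected-involution {E = E} σ σ-involutive E⇒E′ E′⇒E = mk⇔
  (Connected-map σ E⇒E′)
  (λ c → subst₂ (Connected E) (σ-involutive _) (σ-involutive _) (Connected-map σ E′⇒E c))

==B⇒≡ : ∀ a b → T (a ==B b) → a ≡ b
==B⇒≡ true  true  _ = refl
==B⇒≡ false false _ = refl

==B-refl : ∀ a → T (a ==B a)
==B-refl true  = tt
==B-refl false = tt

module _ {n : ℕ} where

  Pts : Set
  Pts = List (Pt n)

  Edges : Set
  Edges = List (Pt n × Pt n)

  ==P⇒≡ : ∀ (x y : Pt n) → T (x ==P y) → x ≡ y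
  ==P⇒≡ ((e , s) , h) ((e′ , s′) , h′) eq
    with e≡e′ , sh≡s′h′ ← to T-∧ eq
    with s≡s′ , h≡h′ ← to T-∧ sh≡s′h′
    with refl ← toℕ-injective (≡ᵇ⇒≡ (toℕ e) (toℕ e′) e≡e′)
       | refl ← ==B⇒≡ s s′ s≡s′
       | refl ← ==B⇒≡ h h′ h≡h′ = refl

  ==P-refl : ∀ (x : Pt n) → T (x ==P x)
  ==P-refl ((e , s) , h) = from T-∧ (≡⇒≡ᵇ (toℕ e) (toℕ e) refl , from T-∧ (==B-refl s , ==B-refl h))

  memb⇔∈ : ∀ {x : Pt n} {S} → T (memb x S) ⇔ x ∈ S
  memb⇔∈ {x} {S} = mk⇔ (Any.map (==P⇒≡ x _) ∘ from (any⇔ {xs = S}))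
                       (to any⇔ ∘ Any.map (λ { refl → ==P-refl x }))

  memb-mono : ∀ {S S′ : Pts} → S ⊆ S′ → ∀ {v} → T (memb v S) → T (memb v S′)
  memb-mono S⊆S′ {v} = from (memb⇔∈ {v}) ∘ S⊆S′ ∘ to (memb⇔∈ {v})

  allPts-complete : ∀ (x : Pt n) → x ∈ allPts n
  allPts-complete ((e , s) , h) =
    ∈-concatMap⁺ _ (lose (∈-concatMap⁺ _ (lose (∈-allFin e) (bothSides s))) (bothSides h))
    where
    bothSides : ∀ {X : Set} {x : X} b → (x , b) ∈ (x , false) ∷ (x , true) ∷ []
    bothSides false = here refl
    bothSides true  = there (here refl)

  step-⊇ : ∀ (E : Edges) S → S ⊆ step E S
  step-⊇ E S = ∈-++⁺ˡ

  step-sound : ∀ (E : Edges) S {x} → x ∈ step E S → x ∈ S ⊎ ∃[ a ] a ∈ S × SymClosure (Edge E) a x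
  step-sound E S x∈ with ∈-++⁻ S x∈
  ... | inj₁ x∈S = inj₁ x∈S
  ... | inj₂ x∈new with (a , b) , ab∈E , x∈ab ← find (∈-concatMap⁻ _ {xs = E} x∈new)
                   with ∈-++⁻ (if memb a S then b ∷ [] else []) x∈ab
  ... | inj₁ x∈b with a∈S , refl ← ∈-if⁻ (memb a S) x∈b = inj₂ (a , to memb⇔∈ a∈S , fwd ab∈E)
  ... | inj₂ x∈a with b∈S , refl ← ∈-if⁻ (memb b S) x∈a = inj₂ (b , to memb⇔∈ b∈S , bwd ab∈E)

  step-complete : ∀ (E : Edges) S {a x} → a ∈ S → SymClosure (Edge E) a x → x ∈ step E S
  step-complete E S a∈S (fwd ax∈E) =
    ∈-++⁺ʳ S (∈-concatMap⁺ _ (lose ax∈E (∈-++⁺ˡ (∈-if⁺ (from memb⇔∈ a∈S)))))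
  step-complete E S {a} {x} a∈S (bwd xa∈E) =
    ∈-++⁺ʳ S (∈-concatMap⁺ _ (lose xa∈E
      (∈-++⁺ʳ (if memb x S then a ∷ [] else []) (∈-if⁺ (from memb⇔∈ a∈S)))))

  iter-⊇ : ∀ k (E : Edges) S → S ⊆ iter k E S
  iter-⊇ zero    E S = λ x∈ → x∈
  iter-⊇ (suc k) E S = iter-⊇ k E (step E S) ∘ step-⊇ E S

  iter-sound : ∀ k (E : Edges) S {y} → (∀ {z} → z ∈ S → Connected E y z) →
               ∀ {x} → x ∈ iter k E S → Connected E y x
  iter-sound zero    E S S-conn = S-conn
  iter-sound (suc k) E S {y} S-conn = iter-sound k E (step E S) step-conn
    where
    step-conn : ∀ {z} → z ∈ step E S → Connected E y z
    step-conn z∈ with step-sound E S z∈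
    ... | inj₁ z∈S             = S-conn z∈S
    ... | inj₂ (a , a∈S , a~z) = S-conn a∈S Star.◅◅ (a~z ◅ ε)

  closed-Connected : ∀ (E : Edges) S → step E S ⊆ S → ∀ {y x} → y ∈ S → Connected E y x → x ∈ S
  closed-Connected E S closed y∈S ε         = y∈S
  closed-Connected E S closed y∈S (y~z ◅ c) = closed-Connected E S closed (closed (step-complete E S y∈S y~z)) c

  missing : Pts → Pts → ℕ
  missing S []      = 0
  missing S (v ∷ V) = unseen (memb v S) + missing S V

  missing-anti : ∀ {S S′ : Pts} → S ⊆ S′ → ∀ V → missing S′ V ≤ missing S V
  missing-anti S⊆S′ []      = z≤n
  missing-anti S⊆S′ (v ∷ V) = +-mono-≤ (unseen-anti (memb-mono S⊆S′ {v})) (missing-anti S⊆S′ V)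

  missing-< : ∀ {S S′ V : Pts} {v} → S ⊆ S′ → v ∈ V → v ∈ S′ → ¬ v ∈ S → missing S′ V < missing S V
  missing-< {V = v ∷ V} S⊆S′ (here refl) v∈S′ v∉S =
    +-mono-<-≤ (unseen-< (from memb⇔∈ v∈S′) (v∉S ∘ to memb⇔∈)) (missing-anti S⊆S′ V)
  missing-< {V = w ∷ V} S⊆S′ (there v∈V) v∈S′ v∉S =
    +-mono-≤-< (unseen-anti (memb-mono S⊆S′ {w})) (missing-< S⊆S′ v∈V v∈S′ v∉S)

  missing≤length : ∀ (S V : Pts) → missing S V ≤ length V
  missing≤length S []      = z≤n
  missing≤length S (v ∷ V) = +-mono-≤ (unseen-anti {false} λ ()) (missing≤length S V)

  -- Each round either closes S under adjacency or adds a point of V, so missing S V rounds suffice.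
  iter-complete : ∀ {E : Edges} {V} → (∀ x → x ∈ V) → ∀ k S → missing S V ≤ k →
                  ∀ {y x} → y ∈ S → Connected E y x → x ∈ iter k E S
  iter-complete {E} total k S bound y∈S c with all? (λ v → T? (memb v S)) (step E S)
  ... | yes closed = iter-⊇ k E S (closed-Connected E S (to memb⇔∈ ∘ All.lookup closed) y∈S c)
  ... | no ¬closed with v , v∈step , v∉S ← find (¬All⇒Any¬ (λ v → T? (memb v S)) _ ¬closed)
                   with k | <-≤-trans (missing-< (step-⊇ E S) (total v) v∈step (v∉S ∘ from memb⇔∈)) bound
  ... | suc k | s≤s bound′ = iter-complete total k (step E S) bound′ (step-⊇ E S y∈S) c

  linked : Pts → Edges → Pt n → Pt n → Bool
  linked V E y x = memb x (closure V E y)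

  linked⇔Connected : ∀ {V : Pts} {E : Edges} → (∀ x → x ∈ V) →
                     ∀ y x → T (linked V E y x) ⇔ Connected E y x
  linked⇔Connected {V} {E} total y x = mk⇔
    (iter-sound (length V) E [ y ] (λ { (here refl) → ε }) ∘ to memb⇔∈)
    (from memb⇔∈ ∘ iter-complete total (length V) [ y ] (missing≤length [ y ] V) (here refl))

  linked-≡ : ∀ {V : Pts} → (∀ x → x ∈ V) → ∀ {E E′ y x y′ x′} →
             (Connected E y x ⇔ Connected E′ y′ x′) → linked V E y x ≡ linked V E′ y′ x′
  linked-≡ total {y = y} {x} {y′} {x′} E⇔E′ =
    T-injective (mk⇔ (from (linked⇔Connected total y′ x′) ∘ to E⇔E′ ∘ to (linked⇔Connected total y x))
                     (from (linked⇔Connected total y x) ∘ from E⇔E′ ∘ to (linked⇔Connected total y′ x′)))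

  linked-sym : ∀ {V : Pts} {E : Edges} → (∀ x → x ∈ V) → ∀ y x → linked V E y x ≡ linked V E x y
  linked-sym total y x = linked-≡ total (mk⇔ (EqClosure.symmetric _) (EqClosure.symmetric _))

  linked-trans : ∀ {V : Pts} {E : Edges} → (∀ x → x ∈ V) → ∀ x y z →
                 T (linked V E x y) → T (linked V E y z) → T (linked V E x z)
  linked-trans total x y z xy yz = from (linked⇔Connected total x z)
    (to (linked⇔Connected total x y) xy Star.◅◅ to (linked⇔Connected total y z) yz)

  countReps≡countNew : ∀ (V : Pts) E pre xs → countReps V E pre xs ≡ countNew (linked V E) pre xs
  countReps≡countNew V E pre []       = refl
  countReps≡countNew V E pre (x ∷ xs) =
    cong (unseen (seen (linked V E) pre x) +_) (countReps≡countNew V E (pre ++ [ x ]) xs)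

  components-relabel : ∀ {E E′ : Edges} (σ : Pt n → Pt n) → map σ (allPts n) ↭ allPts n →
                       (∀ {y x} → Connected E y x ⇔ Connected E′ (σ y) (σ x)) →
                       components (allPts n) E ≡ components (allPts n) E′
  components-relabel {E} {E′} σ σ-permutes E⇔E′ = begin
    components V E                      ≡⟨ countReps≡countNew V E [] V ⟩
    countNew (linked V E) [] V          ≡⟨ countNew-map _ _ σ (λ y x → linked-≡ total E⇔E′) [] V ⟩
    countNew (linked V E′) [] (map σ V) ≡⟨ countNew-↭ _ (linked-sym total) (linked-trans total) ↭.refl σ-permutes ⟩
    countNew (linked V E′) [] V         ≡⟨ countReps≡countNew V E′ [] V ⟨
    components V E′                     ∎
    where
    open ≡-Reasoning
    V = allPts n
    total = allPts-complete

  gapsAndPairings-map : ∀ {gs gs′ : Edges} {f f′ : Fin n → Edges} (σ : Pt n → Pt n) →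
                    (∀ {a b} → (a , b) ∈ gs → (σ a , σ b) ∈ gs′) →
                    (∀ e {a b} → (a , b) ∈ f e → SymClosure (Edge (f′ e)) (σ a) (σ b)) →
                    ∀ {a b} → Edge (gs ++ concatMap f (allFin n)) a b →
                    SymClosure (Edge (gs′ ++ concatMap f′ (allFin n))) (σ a) (σ b)
  gapsAndPairings-map {gs} {gs′} {f} {f′} σ gaps⇒ pairings⇒ ab∈ with ∈-++⁻ gs ab∈
  ... | inj₁ ab∈gs = fwd (∈-++⁺ˡ (gaps⇒ ab∈gs))
  ... | inj₂ ab∈pairings with e , ab∈fe ← Any.satisfied (∈-concatMap⁻ f {xs = allFin n} ab∈pairings) =
    SymClosure.map (λ cd∈ → ∈-++⁺ʳ gs′ (∈-concatMap⁺ f′ (lose (∈-allFin e) cd∈))) (pairings⇒ e ab∈fe)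

-- Partial Petrials and Penrose states

rotate-map : ∀ (f : A → B) xs → rotate (map f xs) ≡ map f (rotate xs)
rotate-map f []       = refl
rotate-map f (x ∷ xs) = sym (map-++ f xs [ x ])

gaps-map : ∀ {n} (t : Pt n → Pt n) → (∀ a → entryPt (t a) ≡ t (entryPt a)) →
           ∀ xs → gaps (map t xs) ≡ map (Product.map t t) (gaps xs)
gaps-map t t-entryPt xs = begin
  zipWith corner (map t xs) (rotate (map t xs))
    ≡⟨ cong (zipWith corner (map t xs)) (rotate-map t xs) ⟩
  zipWith corner (map t xs) (map t (rotate xs))
    ≡⟨ zipWith-map corner t t xs (rotate xs) ⟩
  zipWith (λ a b → corner (t a) (t b)) xs (rotate xs)
    ≡⟨ zipWith-cong (λ a b → cong (t a ,_) (t-entryPt b)) xs (rotate xs) ⟩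
  zipWith (λ a b → Product.map t t (corner a b)) xs (rotate xs)
    ≡⟨ map-zipWith corner (Product.map t t) xs (rotate xs) ⟨
  map (Product.map t t) (gaps xs) ∎
  where
  open ≡-Reasoning
  corner = λ a b → (exitPt a , entryPt b)

-- Exchanges the head and tail of the arrow (e , true) for e ∈ A, as partialPetrial reverses it.
twist : ∀ {n} → Subset n → Pt n → Pt n
twist A ((e , s) , h) = ((e , s) , (if s ∧ inA A e then not h else h))

vstateOf : Side → VState
vstateOf outside = whiteSplit
vstateOf inside  = crossing

penroseStateOf : ∀ {n} → Subset n → Vec VState n
penroseStateOf = Vec.map vstateOf

module _ {n} (A : Subset n) where

  twist-involutive : ∀ x → twist A (twist A x) ≡ x
  twist-involutive ((e , s) , h) with s ∧ inA A e
  ... | true  = cong ((e , s) ,_) (not-involutive h)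
  ... | false = refl

  twist-entryPt : ∀ a → entryPt (twist A a) ≡ twist A (entryPt a)
  twist-entryPt ((e , s) , h) with s ∧ inA A e
  ... | true  = refl
  ... | false = refl

  twist-permutes : map (twist A) (allPts n) ↭ allPts n
  twist-permutes =
    ↭.trans (↭-reflexive (map-concatMap (twist A) _ (allEnds n))) (concatMap-↭ bothSides (allEnds n))
    where
    bothSides : ∀ (x : End n) →
                map (twist A) ((x , false) ∷ (x , true) ∷ []) ↭ (x , false) ∷ (x , true) ∷ []
    bothSides (e , s) with s ∧ inA A e
    ... | true  = ↭.swap _ _ ↭.refl
    ... | false = ↭.refl

  lookup-penroseStateOf : ∀ e → lookup (penroseStateOf A) e ≡ vstateOf (inA A e)
  lookup-penroseStateOf e = trans (lookup-map e vstateOf A) (cong vstateOf (sym inA≡lookup))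
    where
    inA≡lookup : inA A e ≡ lookup A e
    inA≡lookup with lookup A e
    ... | inside  = refl
    ... | outside = refl

  edgeSides-twist : ∀ e {a b} → (a , b) ∈ edgeSides e →
                    SymClosure (Edge (split e (lookup (penroseStateOf A) e))) (twist A a) (twist A b)
  edgeSides-twist e (here refl) rewrite lookup-penroseStateOf e with inA A e
  ... | inside  = fwd (there (here refl))
  ... | outside = fwd (here refl)
  edgeSides-twist e (there (here refl)) rewrite lookup-penroseStateOf e with inA A e
  ... | inside  = bwd (here refl)
  ... | outside = fwd (there (here refl))

  split-twist : ∀ e {a b} → (a , b) ∈ split e (lookup (penroseStateOf A) e) →
                SymClosure (Edge (edgeSides e)) (twist A a) (twist A b)
  split-twist e ab∈ rewrite lookup-penroseStateOf e with inA A e in eq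
  split-twist e (here refl)         | inside  rewrite eq = bwd (there (here refl))
  split-twist e (there (here refl)) | inside  rewrite eq = fwd (here refl)
  split-twist e (here refl)         | outside rewrite eq = fwd (here refl)
  split-twist e (there (here refl)) | outside rewrite eq = fwd (there (here refl))

cr-penroseStateOf : ∀ {n} (A : Subset n) → cr (penroseStateOf A) ≡ ∣ A ∣
cr-penroseStateOf []ᵥ             = refl
cr-penroseStateOf (inside  ∷ᵥ A) = cong suc (cr-penroseStateOf A)
cr-penroseStateOf (outside ∷ᵥ A) = cr-penroseStateOf A

module _ (G : ArrowPresentation) (A : Subset (nE G)) where

  private
    Gᵗ = partialPetrial G A
    twist² = Product.map (twist A) (twist A)

  circle-partialPetrial : ∀ v → circle Gᵗ v ≡ map (twist A) (circle G v)
  circle-partialPetrial v = map-cong (λ { ((e , s) , d) → refl }) (circle G v)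

  allGaps-partialPetrial : allGaps Gᵗ ≡ map twist² (allGaps G)
  allGaps-partialPetrial = begin
    concatMap (λ v → gaps (circle Gᵗ v)) (allFin (nV G))
      ≡⟨ concatMap-cong (λ v → trans (cong gaps (circle-partialPetrial v))
                                     (gaps-map (twist A) (twist-entryPt A) (circle G v))) (allFin (nV G)) ⟩
    concatMap (λ v → map twist² (gaps (circle G v))) (allFin (nV G))
      ≡⟨ map-concatMap twist² (λ v → gaps (circle G v)) (allFin (nV G)) ⟨
    map twist² (allGaps G) ∎
    where open ≡-Reasoning

  isolated-partialPetrial : isolated Gᵗ ≡ isolated G
  isolated-partialPetrial = cong length (filter-≐ (T? ∘ isolatedᵗ) (T? ∘ isolatedᴳ)
    ((λ {v} → subst T (same v)) , (λ {v} → subst T (sym (same v)))) (allFin (nV G)))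
    where
    isolatedᵗ isolatedᴳ : Fin (nV G) → Bool
    isolatedᵗ v = null (circle Gᵗ v)
    isolatedᴳ v = null (circle G v)
    same : ∀ v → isolatedᵗ v ≡ isolatedᴳ v
    same v = trans (cong null (circle-partialPetrial v)) (null-map (twist A) (circle G v))

  curves-penroseStateOf : curves G (penroseStateOf A) ≡ faces Gᵗ
  curves-penroseStateOf =
    cong₂ _+_ (components-relabel (twist A) (twist-permutes A) curves⇔faces) (sym isolated-partialPetrial)
    where
    gapᴳ⇒gapᵗ : ∀ {a b} → (a , b) ∈ allGaps G → (twist A a , twist A b) ∈ allGaps Gᵗ
    gapᴳ⇒gapᵗ {a} {b} ab∈ =
      subst ((twist A a , twist A b) ∈_) (sym allGaps-partialPetrial) (∈-map⁺ twist² ab∈)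
    gapᵗ⇒gapᴳ : ∀ {a b} → (a , b) ∈ allGaps Gᵗ → (twist A a , twist A b) ∈ allGaps G
    gapᵗ⇒gapᴳ {a} {b} ab∈ =
      ∈-map-involution twist² (λ { (a , b) → cong₂ _,_ (twist-involutive A a) (twist-involutive A b) })
                       (subst ((a , b) ∈_) allGaps-partialPetrial ab∈)
    curves⇔faces = Connected-involution (twist A) (twist-involutive A)
      (gapsAndPairings-map (twist A) gapᴳ⇒gapᵗ (split-twist A))
      (gapsAndPairings-map (twist A) gapᵗ⇒gapᴳ (edgeSides-twist A))

allVecs-map : ∀ (f : A → B) xs n → allVecs (map f xs) n ≡ map (Vec.map f) (allVecs xs n)
allVecs-map f xs zero    = refl
allVecs-map f xs (suc n) = begin
  concatMap (λ y → map (y ∷ᵥ_) (allVecs (map f xs) n)) (map f xs)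
    ≡⟨ concatMap-map _ f xs ⟩
  concatMap (λ x → map (f x ∷ᵥ_) (allVecs (map f xs) n)) xs
    ≡⟨ concatMap-cong (λ x → cong (map (f x ∷ᵥ_)) (allVecs-map f xs n)) xs ⟩
  concatMap (λ x → map (f x ∷ᵥ_) (map (Vec.map f) vs)) xs
    ≡⟨ concatMap-cong (λ x → trans (sym (map-∘ vs)) (map-∘ vs)) xs ⟩
  concatMap (λ x → map (Vec.map f) (map (x ∷ᵥ_) vs)) xs
    ≡⟨ map-concatMap (Vec.map f) (λ x → map (x ∷ᵥ_) vs) xs ⟨
  map (Vec.map f) (allVecs xs (suc n)) ∎
  where
  open ≡-Reasoning
  vs = allVecs xs n

penroseStates : ∀ n → filterᵇ isPenrose (allVecs (whiteSplit ∷ blackSplit ∷ crossing ∷ []) n)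
                      ≡ allVecs (whiteSplit ∷ crossing ∷ []) n
penroseStates zero    = refl
penroseStates (suc n) = begin
  filterᵇ isPenrose (concatMap (λ x → map (x ∷ᵥ_) vs) states)
    ≡⟨ filterᵇ-concatMap isPenrose (λ x → map (x ∷ᵥ_) vs) states ⟩
  concatMap (λ x → filterᵇ isPenrose (map (x ∷ᵥ_) vs)) states
    ≡⟨ concatMap-cong (λ x → filterᵇ-map isPenrose (x ∷ᵥ_) vs) states ⟩
  map (whiteSplit ∷ᵥ_) (filterᵇ isPenrose vs) ++ map (blackSplit ∷ᵥ_) (filterᵇ (λ _ → false) vs)
    ++ map (crossing ∷ᵥ_) (filterᵇ isPenrose vs) ++ []
    ≡⟨ cong₂ (λ ws bs → map (whiteSplit ∷ᵥ_) ws ++ map (blackSplit ∷ᵥ_) bs ++ map (crossing ∷ᵥ_) ws ++ [])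
             (penroseStates n) (filter-none (T? ∘ λ _ → false) (All.universal (λ _ ()) vs)) ⟩
  allVecs (whiteSplit ∷ crossing ∷ []) (suc n) ∎
  where
  open ≡-Reasoning
  states = whiteSplit ∷ blackSplit ∷ crossing ∷ []
  vs = allVecs states n

penroseStates≡penroseStateOf : ∀ n → filterᵇ isPenrose (allVecs (whiteSplit ∷ blackSplit ∷ crossing ∷ []) n)
                                     ≡ map penroseStateOf (allVecs (outside ∷ inside ∷ []) n)
penroseStates≡penroseStateOf n = trans (penroseStates n) (allVecs-map vstateOf (outside ∷ inside ∷ []) n)

proposition5p1 : (G : ArrowPresentation) → IsArrowPresentation G →
                 (d : ℕ) → penrosePoly G d ≡ petrialSum G d
proposition5p1 G _ d = cong (λ terms → sumP terms d) (begin
  map penroseTerm (filterᵇ isPenrose (allVecs (whiteSplit ∷ blackSplit ∷ crossing ∷ []) (nE G)))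
    ≡⟨ cong (map penroseTerm) (penroseStates≡penroseStateOf (nE G)) ⟩
  map penroseTerm (map penroseStateOf subsets)
    ≡⟨ map-∘ subsets ⟨
  map (penroseTerm ∘ penroseStateOf) subsets
    ≡⟨ map-cong (λ A → cong₂ (λ k c → monomial ((- 1ℤ) ^ k) c)
                             (cr-penroseStateOf A) (curves-penroseStateOf G A)) subsets ⟩
  map (λ A → monomial ((- 1ℤ) ^ ∣ A ∣) (faces (partialPetrial G A))) subsets ∎)
  where
  open ≡-Reasoning
  subsets = allVecs (outside ∷ inside ∷ []) (nE G)
  penroseTerm : GraphState G → Poly
  penroseTerm s = monomial ((- 1ℤ) ^ cr s) (curves G s)
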